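{- Let $\mathcal{U}$ be a set, let $S$ be a finite set of maps from $\mathcal{U}$ to itself, and let $f:\mathcal{U}\to\mathcal{U}$ be a map sending all of $\mathcal{U}$ to a single element. Let $S_1=S\cup\{f\}$. Let $S^{\le n}$ (resp. $S_1^{\le n}$) be the set of distinct maps represented by words (compositions) of length at most $n$ in elements of $S$ (resp. $S_1$). Then $|S_1^{\le n}|\le 2|S^{\le n}|$ for every $n$. -}

module Defs where

open import Level using (Level)
open import Function using (_∘_; id)
open import Data.Nat using (ℕ; _≤_)
open import Data.List using (List; []; _∷_; foldr; length)
open import Data.List.Relation.Unary.All using (All)
open import Data.List.Membership.Propositional using (_∈_)
open import Data.Product using (Σ; _×_; ∃-syntax)
open import Relation.Binary.PropositionalEquality using (_≡_)
open import Relation.Nullary using (¬_)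

private variable a : Level

eval : {U : Set a} → List (U → U) → U → U
eval = foldr (λ g h → g ∘ h) id

_≗′_ : {U : Set a} → (U → U) → (U → U) → Set a
g ≗′ h = ∀ x → g x ≡ h x

Distinct : {U : Set a} → (U → U) → (U → U) → Set a
Distinct g h = ¬ (g ≗′ h)

InWords : {U : Set a} → List (U → U) → ℕ → (U → U) → Set a
InWords S n g = ∃[ w ] (All (_∈ S) w × length w ≤ n × g ≗′ eval w)

IsConstant : {U : Set a} → (U → U) → Set a
IsConstant {U = U} f = ∃[ c ] ∀ (x : U) → f x ≡ c

-- Fix c with f x ≡ c for all x. In a word over S ∪ {f}, the leftmost letter f
-- discards everything to its right, so the word evaluates either to a word over
-- S or to the constant map x ↦ p c, where the prefix p is a word over S of no
-- greater length. Distinct constant maps x ↦ p c come from distinct maps p, so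
-- a distinct list in S₁^{≤n} splits into a distinct list in S^{≤n} and one that
-- injects into S^{≤n}; the longer of the two has at least half the elements.
module Submission where

open import Defs
open import Level using (Level)
open import Function using (const)
open import Data.Nat using (ℕ; _≤_; _*_; _+_; suc; z≤n; s≤s; _≤?_)
open import Data.Nat.Properties
  using (≤-trans; ≤-reflexive; +-monoˡ-≤; +-identityʳ; +-comm; +-suc; ≰⇒≥)
open import Data.List using (List; []; _∷_; length)
open import Data.List.Relation.Unary.All as All using (All; []; _∷_)
open import Data.List.Relation.Unary.AllPairs using (AllPairs; []; _∷_)
open import Data.List.Relation.Unary.Any using (here; there)
open import Data.List.Relation.Binary.Pointwise using (Pointwise; []; _∷_; Pointwise-length)
open import Data.List.Relation.Binary.Sublist.Propositional using (_⊆_; _⊇_; []; _∷_; _∷ʳ_)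
open import Data.List.Relation.Binary.Sublist.Propositional.Properties using (All-resp-⊆)
open import Data.List.Membership.Propositional using (_∈_)
open import Data.Product using (_×_; ∃-syntax; ∃₂; _,_)
open import Data.Sum using (_⊎_; inj₁; inj₂)
open import Relation.Binary.Core using (Rel; REL)
open import Relation.Binary.Definitions using (_Respects_)
open import Relation.Binary.PropositionalEquality using (_≡_; refl; sym; trans; cong)
open import Relation.Unary using (Pred)
open import Relation.Nullary using (yes; no)

private variable
  a ℓ : Level
  A B : Set a

m≤n⇒m+n≤2*n : ∀ {m n} → m ≤ n → m + n ≤ 2 * n
m≤n⇒m+n≤2*n {m} {n} m≤n = ≤-trans (+-monoˡ-≤ n m≤n) (≤-reflexive (cong (n +_) (sym (+-identityʳ n))))

m+n≤2*m⊎m+n≤2*n : ∀ m n → m + n ≤ 2 * m ⊎ m + n ≤ 2 * n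
m+n≤2*m⊎m+n≤2*n m n with m ≤? n
... | yes m≤n = inj₂ (m≤n⇒m+n≤2*n m≤n)
... | no  m≰n = inj₁ (≤-trans (≤-reflexive (+-comm m n)) (m≤n⇒m+n≤2*n (≰⇒≥ m≰n)))

AllPairs-resp-⊆ : {R : Rel A ℓ} → AllPairs R Respects _⊇_
AllPairs-resp-⊆ []         []       = []
AllPairs-resp-⊆ (_ ∷ʳ σ)   (_ ∷ rs) = AllPairs-resp-⊆ σ rs
AllPairs-resp-⊆ (refl ∷ σ) (r ∷ rs) = All-resp-⊆ σ r ∷ AllPairs-resp-⊆ σ rs

partition-⊎ : {P Q : Pred A ℓ} {xs : List A} → All (λ x → P x ⊎ Q x) xs →
  ∃₂ λ ys zs → ys ⊆ xs × zs ⊆ xs × All P ys × All Q zs × length xs ≡ length ys + length zs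
partition-⊎ [] = [] , [] , [] , [] , [] , [] , refl
partition-⊎ {xs = x ∷ _} (inj₁ px ∷ pqs) with partition-⊎ pqs
... | ys , zs , σ , τ , ps , qs , len = x ∷ ys , zs , refl ∷ σ , x ∷ʳ τ , px ∷ ps , qs , cong suc len
partition-⊎ {xs = x ∷ _} (inj₂ qx ∷ pqs) with partition-⊎ pqs
... | ys , zs , σ , τ , ps , qs , len =
  ys , x ∷ zs , x ∷ʳ σ , refl ∷ τ , ps , qx ∷ qs , trans (cong suc len) (sym (+-suc (length ys) (length zs)))

choose-witnesses : {P : Pred B ℓ} {R : REL A B ℓ} {xs : List A} →
  All (λ x → ∃[ y ] (P y × R x y)) xs → ∃[ ys ] (All P ys × Pointwise R xs ys)
choose-witnesses [] = [] , [] , []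
choose-witnesses ((y , py , rxy) ∷ ws) with choose-witnesses ws
... | ys , ps , rs = y ∷ ys , py ∷ ps , rxy ∷ rs

module _ {U : Set a} {F : (U → U) → (U → U)} (F-cong : ∀ {h k} → h ≗′ k → F h ≗′ F k) where

  distinct-preimages : {gs hs : List (U → U)} →
    Pointwise (λ g h → g ≗′ F h) gs hs → AllPairs Distinct gs → AllPairs Distinct hs
  distinct-preimages []         []         = []
  distinct-preimages (g≗Fh ∷ rs) (dg ∷ dgs) = distinct-from g≗Fh rs dg ∷ distinct-preimages rs dgs
    where
    distinct-from : ∀ {g h gs hs} → g ≗′ F h →
      Pointwise (λ g h → g ≗′ F h) gs hs → All (Distinct g) gs → All (Distinct h) hs
    distinct-from g≗Fh []            []          = []
    distinct-from g≗Fh (g′≗Fh′ ∷ rs) (d ∷ ds) =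
      (λ h≗h′ → d (λ x → trans (g≗Fh x) (trans (F-cong h≗h′ x) (sym (g′≗Fh′ x)))))
      ∷ distinct-from g≗Fh rs ds

module _ {U : Set a} (S : List (U → U)) {f : U → U} (c : U) (f-const : ∀ x → f x ≡ c) where

  word-over-S-or-constant : ∀ w → All (_∈ f ∷ S) w →
    All (_∈ S) w ⊎ ∃[ p ] (All (_∈ S) p × length p ≤ length w × eval w ≗′ const (eval p c))
  word-over-S-or-constant []      []               = inj₁ []
  word-over-S-or-constant (_ ∷ w) (here refl ∷ _)  = inj₂ ([] , [] , z≤n , λ x → f-const (eval w x))
  word-over-S-or-constant (g ∷ w) (there g∈S ∷ ws) with word-over-S-or-constant w ws
  ... | inj₁ w⊆S                   = inj₁ (g∈S ∷ w⊆S)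
  ... | inj₂ (p , p⊆S , p≤w , w≗p) = inj₂ (g ∷ p , g∈S ∷ p⊆S , s≤s p≤w , λ x → cong g (w≗p x))

  InWords-∷-constant : ∀ {n g} → InWords (f ∷ S) n g →
    InWords S n g ⊎ ∃[ h ] (InWords S n h × g ≗′ const (h c))
  InWords-∷-constant (w , w⊆f∷S , w≤n , g≗w) with word-over-S-or-constant w w⊆f∷S
  ... | inj₁ w⊆S = inj₁ (w , w⊆S , w≤n , g≗w)
  ... | inj₂ (p , p⊆S , p≤w , w≗p) =
    inj₂ (eval p , (p , p⊆S , ≤-trans p≤w w≤n , λ _ → refl) , λ x → trans (g≗w x) (w≗p x))

lemma4p1 : ∀ {a : Level} {U : Set a} (S : List (U → U)) (f : U → U) →
    IsConstant f → (n : ℕ) →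
    (L₁ : List (U → U)) → All (InWords (f ∷ S) n) L₁ → AllPairs Distinct L₁ →
    ∃[ L ] (All (InWords S n) L × AllPairs Distinct L × length L₁ ≤ 2 * length L)
lemma4p1 S f (c , f-const) n L₁ inWords distinct
  with partition-⊎ (All.map (InWords-∷-constant S c f-const) inWords)
... | LA , LB , LA⊆L₁ , LB⊆L₁ , inWordsA , constB , len
  with choose-witnesses constB
... | W , inWordsW , LB≗W
  with m+n≤2*m⊎m+n≤2*n (length LA) (length W) | trans len (cong (length LA +_) (Pointwise-length LB≗W))
... | inj₁ ≤2*LA | len′ = LA , inWordsA , AllPairs-resp-⊆ LA⊆L₁ distinct , ≤-trans (≤-reflexive len′) ≤2*LA
... | inj₂ ≤2*W  | len′ = W , inWordsW , distinctW , ≤-trans (≤-reflexive len′) ≤2*W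
  where
  distinctW : AllPairs Distinct W
  distinctW = distinct-preimages (λ h≗k _ → h≗k c) LB≗W (AllPairs-resp-⊆ LB⊆L₁ distinct)
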